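{- For every $G\in\mathbb{Np}^\infty$, $\infty\succcurlyeq G$ and $G\succcurlyeq\overline{\infty}$.
   Context: Affine normal play forms $\mathbb{Np}^\infty$ are defined recursively: two atomic forms $\infty$ and $\overline{\infty}$ with no options; every other form is $G=\{G^{\mathcal L}\mid G^{\mathcal R}\}$ with finite nonempty sets of previously constructed forms as Left and Right options. Disjunctive sum: $\infty+X=X+\infty=\infty$ for $X\neq\overline{\infty}$; $\overline{\infty}+X=X+\overline{\infty}=\overline{\infty}$ for $X\ne\infty$; $\infty+\overline{\infty}$ undefined; otherwise $G+H=\{G^L+H,G+H^L\mid G^R+H,G+H^R\}$. Outcomes: Left wins $\infty$ and Right wins $\overline{\infty}$ whoever moves; otherwise play alternates, Left moving first wins iff some Left option is won by Left moving second, Left moving second wins iff every Right option is won by Left moving first, symmetrically for Right. $o(G)$ is $\mathscr L$ (Left wins moving first and second), $\mathscr R$ (Right wins either way), $\mathscr N$ (first player wins), $\mathscr P$ (second player wins), partially ordered by $\mathscr L>\mathscr N>\mathscr R$, $\mathscr L>\mathscr P>\mathscr R$, with $\mathscr N,\mathscr P$ incomparable. For $G,H\in\mathbb{Np}^\infty$, $G\succcurlyeq H$ means $o(G+X)\geqslant o(H+X)$ for every $X\in\mathbb{Np}^\infty\setminus\{\infty,\overline\infty\}$. -}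

module Defs where

open import Data.Bool using (Bool; true; false; _∧_; _∨_)
open import Data.List using (List; []; _∷_; _++_)
open import Data.List.NonEmpty using (List⁺; _∷_)

-- Affine normal play forms Np^∞.  Options are finite nonempty collections,
-- represented as nonempty lists (order/multiplicity is irrelevant for
-- everything below).
data Form : Set where
  ∞    : Form
  ∞̄    : Form
  ⟨_∣_⟩ : List⁺ Form → List⁺ Form → Form

data NonAtomic : Form → Set where
  nonAtomic : (L R : List⁺ Form) → NonAtomic ⟨ L ∣ R ⟩

_++⁺_ : {A : Set} → List⁺ A → List⁺ A → List⁺ A
(x ∷ xs) ++⁺ (y ∷ ys) = x ∷ (xs ++ (y ∷ ys))

-- The case ∞ + ∞̄ is undefined in the paper; here it is
-- given the junk value ∞.  It never arises in the statement below, since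
-- there one summand is always non-atomic (and then, recursively, every
-- sum formed has a non-atomic summand).
mutual
  _+_ : Form → Form → Form
  ∞ + _ = ∞
  ∞̄ + ∞ = ∞
  ∞̄ + _ = ∞̄
  ⟨ GL ∣ GR ⟩ + ∞ = ∞
  ⟨ GL ∣ GR ⟩ + ∞̄ = ∞̄
  ⟨ GL ∣ GR ⟩ + ⟨ XL ∣ XR ⟩ =
    ⟨ mapL⁺ GL ⟨ XL ∣ XR ⟩ ++⁺ mapR⁺ ⟨ GL ∣ GR ⟩ XL
    ∣ mapL⁺ GR ⟨ XL ∣ XR ⟩ ++⁺ mapR⁺ ⟨ GL ∣ GR ⟩ XR ⟩

  mapL⁺ : List⁺ Form → Form → List⁺ Form
  mapL⁺ (g ∷ gs) X = (g + X) ∷ mapL gs X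

  mapL : List Form → Form → List Form
  mapL [] X = []
  mapL (g ∷ gs) X = (g + X) ∷ mapL gs X

  mapR⁺ : Form → List⁺ Form → List⁺ Form
  mapR⁺ G (x ∷ xs) = (G + x) ∷ mapR G xs

  mapR : Form → List Form → List Form
  mapR G [] = []
  mapR G (x ∷ xs) = (G + x) ∷ mapR G xs

-- Who wins.  leftFirst G  : Left wins G moving first.
--            leftSecond G : Left wins G moving second.
--            rightFirst G / rightSecond G : likewise for Right.
mutual
  leftFirst : Form → Bool
  leftFirst ∞ = true
  leftFirst ∞̄ = false
  leftFirst ⟨ L ∣ R ⟩ = anyLS⁺ L

  leftSecond : Form → Bool
  leftSecond ∞ = true
  leftSecond ∞̄ = false
  leftSecond ⟨ L ∣ R ⟩ = allLF⁺ R

  anyLS⁺ : List⁺ Form → Bool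
  anyLS⁺ (g ∷ gs) = leftSecond g ∨ anyLS gs
  anyLS : List Form → Bool
  anyLS [] = false
  anyLS (g ∷ gs) = leftSecond g ∨ anyLS gs

  allLF⁺ : List⁺ Form → Bool
  allLF⁺ (g ∷ gs) = leftFirst g ∧ allLF gs
  allLF : List Form → Bool
  allLF [] = true
  allLF (g ∷ gs) = leftFirst g ∧ allLF gs

mutual
  rightFirst : Form → Bool
  rightFirst ∞ = false
  rightFirst ∞̄ = true
  rightFirst ⟨ L ∣ R ⟩ = anyRS⁺ R

  rightSecond : Form → Bool
  rightSecond ∞ = false
  rightSecond ∞̄ = true
  rightSecond ⟨ L ∣ R ⟩ = allRF⁺ L

  anyRS⁺ : List⁺ Form → Bool
  anyRS⁺ (g ∷ gs) = rightSecond g ∨ anyRS gs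
  anyRS : List Form → Bool
  anyRS [] = false
  anyRS (g ∷ gs) = rightSecond g ∨ anyRS gs

  allRF⁺ : List⁺ Form → Bool
  allRF⁺ (g ∷ gs) = rightFirst g ∧ allRF gs
  allRF : List Form → Bool
  allRF [] = true
  allRF (g ∷ gs) = rightFirst g ∧ allRF gs

data Outcome : Set where
  𝓛 𝓝 𝓟 𝓡 : Outcome

-- o(G), determined from Left's win data: L if Left wins moving first and
-- second; N if Left wins moving first but not second (Right then wins
-- moving first); P if Left wins moving second but not first (Right then
-- wins moving second); R if Left wins neither (Right wins either way).
-- (Every form has a winner in each case.)
outcomeOf : Bool → Bool → Outcome
outcomeOf true  true  = 𝓛
outcomeOf true  false = 𝓝
outcomeOf false true  = 𝓟
outcomeOf false false = 𝓡

o : Form → Outcome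
o G = outcomeOf (leftFirst G) (leftSecond G)

data _≥ₒ_ : Outcome → Outcome → Set where
  ≥-refl : ∀ {a} → a ≥ₒ a
  𝓛≥𝓝 : 𝓛 ≥ₒ 𝓝
  𝓛≥𝓟 : 𝓛 ≥ₒ 𝓟
  𝓛≥𝓡 : 𝓛 ≥ₒ 𝓡
  𝓝≥𝓡 : 𝓝 ≥ₒ 𝓡
  𝓟≥𝓡 : 𝓟 ≥ₒ 𝓡

_≽_ : Form → Form → Set
G ≽ H = (X : Form) → NonAtomic X → o (G + X) ≥ₒ o (H + X)

{-# OPTIONS --safe #-}
module Submission where

open import Data.Product using (_×_; _,_)
open import Defs

𝓛-greatest : ∀ a → 𝓛 ≥ₒ a
𝓛-greatest 𝓛 = ≥-refl
𝓛-greatest 𝓝 = 𝓛≥𝓝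
𝓛-greatest 𝓟 = 𝓛≥𝓟
𝓛-greatest 𝓡 = 𝓛≥𝓡

𝓡-least : ∀ a → a ≥ₒ 𝓡
𝓡-least 𝓛 = 𝓛≥𝓡
𝓡-least 𝓝 = 𝓝≥𝓡
𝓡-least 𝓟 = 𝓟≥𝓡
𝓡-least 𝓡 = ≥-refl

-- For non-atomic X the sums ∞ + X and ∞̄ + X compute to ∞ and ∞̄, whose
-- outcomes are 𝓛 and 𝓡; matching on nonAtomic lets ∞̄ + X reduce.
theorem2p3 : (G : Form) → (∞ ≽ G) × (G ≽ ∞̄)
theorem2p3 G = (λ { X (nonAtomic L R) → 𝓛-greatest (o (G + X)) })
             , (λ { X (nonAtomic L R) → 𝓡-least (o (G + X)) })
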